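{- Every $n$-vertex maximal outerplane graph $G$ has a flippable set of at least $\tfrac{1}{3}(n-3)$ edges. Moreover, for infinitely many $n$ there is an $n$-vertex maximal outerplane graph in which every flippable set has at most $\tfrac{1}{3}(n-3)$ edges.
   Context: A plane graph is outerplane if every vertex lies on the outer face; an (edge-)maximal outerplane graph has every internal (non-outer) face a triangle. An internal edge is one not on the boundary of the outer face. For an internal edge $vw$ with incident internal faces $(v,w,x)$ and $(w,v,y)$, flipping $vw$ replaces it by the edge $xy$ drawn inside the quadrilateral $vxwy$. For a set $S$ of internal edges, $\mathcal{F}(G,S)$ is the embedded graph obtained by flipping every edge of $S$; $S$ is flippable if $\mathcal{F}(G,S)$ is again a (simple) maximal outerplane graph. Only internal edges may be flipped. -}

module Defs where

open import Data.Nat using (ℕ; zero; suc; _+_; _*_; _∸_; _≤_; _<_; _⊓_; _⊔_)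
open import Data.Nat.Properties using () renaming (_≟_ to _≟ℕ_)
open import Data.Product using (Σ; _×_; _,_; proj₁; proj₂; ∃)
open import Data.Product.Properties using (≡-dec)
open import Data.Sum using (_⊎_)
open import Data.List using (List; filter; map; _++_; length)
open import Data.List.Relation.Unary.All using (All)
open import Data.List.Relation.Unary.AllPairs using (AllPairs)
open import Data.List.Relation.Unary.Unique.Propositional using (Unique)
open import Relation.Nullary using (¬_)
open import Relation.Nullary.Decidable using (¬?)
open import Relation.Binary.PropositionalEquality using (_≡_; _≢_)
open import Relation.Binary.Definitions using (DecidableEquality)

-- Convention: an n-vertex maximal outerplane graph (n ≥ 3) is encoded with
-- vertices 0,…,n-1 labelled in the cyclic order of its outer (Hamiltonian)
-- boundary cycle; the outer-boundary edges are the polygon sides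
-- {i,i+1} and {0,n-1}; the internal edges are given by a list D of
-- "diagonals" (i , j) with i < j.  Since the outer boundary is a convex
-- polygon position, two internal edges cross iff their endpoints interleave.

Edge : Set
Edge = ℕ × ℕ

_≟E_ : DecidableEquality Edge
_≟E_ = ≡-dec _≟ℕ_ _≟ℕ_

open import Data.List.Membership.DecPropositional _≟E_ using (_∈_; _∉_; _∈?_)

IsSide : ℕ → Edge → Set
IsSide n (i , j) = (suc i ≡ j × j < n) ⊎ (i ≡ 0 × suc j ≡ n)

IsDiagonal : ℕ → Edge → Set
IsDiagonal n (i , j) = i < j × j < n × ¬ IsSide n (i , j)

Crosses : Edge → Edge → Set
Crosses (a , b) (c , d) = (a < c × c < b × b < d) ⊎ (c < a × a < d × d < b)

IsEdge : ℕ → List Edge → Edge → Set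
IsEdge n D e = IsSide n e ⊎ e ∈ D

IsOuterplane : ℕ → List Edge → Set
IsOuterplane n D =
  All (IsDiagonal n) D × Unique D × AllPairs (λ e f → ¬ Crosses e f) D

IsMaxOuterplane : ℕ → List Edge → Set
IsMaxOuterplane n D =
  3 ≤ n × IsOuterplane n D ×
  ((e : Edge) → IsDiagonal n e → e ∉ D → Σ Edge λ f → f ∈ D × (Crosses e f ⊎ Crosses f e))

edge : ℕ → ℕ → Edge
edge x y = (x ⊓ y , x ⊔ y)

-- FlipOf n D (v , w) e' : the internal edge vw has incident internal faces
-- (v,w,x) (x strictly between v and w) and (w,v,y) (y on the other arc),
-- and e' = xy is the edge replacing vw after the flip.
FlipOf : ℕ → List Edge → Edge → Edge → Set
FlipOf n D (v , w) e' = Σ ℕ λ x → Σ ℕ λ y →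
  (v < x × x < w) × (y < v ⊎ (w < y × y < n)) ×
  IsEdge n D (edge v x) × IsEdge n D (edge x w) ×
  IsEdge n D (edge v y) × IsEdge n D (edge y w) ×
  e' ≡ edge x y

-- A flip set, given as a list P of pairs (e , e') where e ∈ S is an internal
-- edge to be flipped and e' is the edge replacing it.
FlipSet : List (Edge × Edge) → List Edge
FlipSet P = map proj₁ P

flipAll : List Edge → List (Edge × Edge) → List Edge
flipAll D P = filter (λ e → ¬? (e ∈? FlipSet P)) D ++ map proj₂ P

Flippable : ℕ → List Edge → List (Edge × Edge) → Set
Flippable n D P =
  All (λ p → proj₁ p ∈ D × FlipOf n D (proj₁ p) (proj₂ p)) P ×
  Unique (FlipSet P) ×
  IsMaxOuterplane n (flipAll D P)

-- A flip of an internal edge replaces it by the other diagonal of the quadrilateral formed by its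
-- two triangles. Flips of edges no two of which lie on a common triangle can be performed together:
-- each new edge crosses only the edge it replaces, and every diagonal crossing a flipped edge still
-- crosses a side of its quadrilateral. Such edge sets are matchings of the dual tree of the n − 2
-- triangles. Rooted at the triangle on the side (0 , n − 1) this tree is binary, and matching each
-- triangle greedily with a child that is still unmatched gives, on a subtree with N triangles, a
-- matching M with N ≤ 3|M| + 1, and N ≤ 3|M| when the root is matched; hence |M| ≥ (n − 3)/3.
-- Conversely, two edges of one triangle cannot both be flipped, since the flip of each edge of a
-- triangle uses the opposite corner and the new edges cross. Gluing triangles (0 , m , m + 2) with
-- ears at m + 1 and m + 3 repeatedly onto the side (0 , m) gives graphs whose 3k internal edges are
-- the edges of k triangles, so no flippable set has more than k = (n − 3)/3 edges.

module Submission where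

open import Defs
open import Data.Nat
open import Data.Nat.Properties
open import Data.Nat.Tactic.RingSolver using (solve-∀)
open import Data.Product hiding (map)
open import Data.Sum hiding (map)
open import Data.Empty using (⊥; ⊥-elim)
open import Data.List using (List; []; _∷_; map; filter; _++_; length)
open import Data.List.Properties using (length-++; length-map)
open import Data.List.Relation.Unary.All as All using (All; []; _∷_)
import Data.List.Relation.Unary.All.Properties as All
open import Data.List.Relation.Unary.Any as Any using (Any; here; there)
open import Data.List.Relation.Unary.AllPairs as AllPairs using (AllPairs; []; _∷_)
import Data.List.Relation.Unary.AllPairs.Properties as AllPairs
open import Data.List.Relation.Unary.Unique.Propositional using (Unique)
import Data.List.Relation.Unary.Unique.Propositional.Properties as Unique
open import Data.List.Membership.Propositional using (_∈_; _∉_)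
open import Data.List.Membership.Propositional.Properties
  using (∈-map⁺; ∈-map⁻; ∈-filter⁺; ∈-filter⁻; ∈-++⁺ˡ; ∈-++⁺ʳ)
open import Data.List.Membership.DecPropositional _≟E_ using (_∈?_)
open import Relation.Nullary using (¬_; Dec; yes; no)
open import Relation.Nullary.Decidable using (¬?; _×-dec_; _⊎-dec_)
open import Relation.Unary using (Decidable)
open import Relation.Binary.PropositionalEquality hiding ([_])
open import Relation.Binary.Definitions using (tri<; tri≈; tri>)
open import Function using (_∘_; id)

allPairs-lookup : ∀ {A : Set} {R : A → A → Set} {xs x y} → AllPairs R xs → x ∈ xs → y ∈ xs →
                  x ≡ y ⊎ R x y ⊎ R y x
allPairs-lookup (_ ∷ _) (here refl) (here refl) = inj₁ refl
allPairs-lookup (Rx ∷ _) (here refl) (there y∈) = inj₂ (inj₁ (All.lookup Rx y∈))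
allPairs-lookup (Rx ∷ _) (there x∈) (here refl) = inj₂ (inj₂ (All.lookup Rx x∈))
allPairs-lookup (_ ∷ Rs) (there x∈) (there y∈) = allPairs-lookup Rs x∈ y∈

allPairs-map-with : ∀ {A : Set} {P : A → Set} {R S : A → A → Set} {xs} →
                    (∀ {x y} → P x → P y → R x y → S x y) → All P xs → AllPairs R xs → AllPairs S xs
allPairs-map-with h [] [] = []
allPairs-map-with h (Px ∷ Ps) (Rx ∷ Rs) =
  All.zipWith (λ (Py , Rxy) → h Px Py Rxy) (Ps , Rx) ∷ allPairs-map-with h Ps Rs

allPairs-++⁻ʳ : ∀ {A : Set} {R : A → A → Set} xs {ys} → AllPairs R (xs ++ ys) → AllPairs R ys
allPairs-++⁻ʳ [] Rs = Rs
allPairs-++⁻ʳ (_ ∷ xs) (_ ∷ Rs) = allPairs-++⁻ʳ xs Rs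

length-filter-split : ∀ {A : Set} {P : A → Set} (P? : Decidable P) xs →
                      length xs ≡ length (filter P? xs) + length (filter (λ x → ¬? (P? x)) xs)
length-filter-split P? [] = refl
length-filter-split P? (x ∷ xs) with P? x
... | yes _ = cong suc (length-filter-split P? xs)
... | no _ = trans (cong suc (length-filter-split P? xs)) (sym (+-suc _ _))

pigeonhole : ∀ {A B : Set} {R : A → B → Set} → (∀ x y → Dec (R x y)) → ∀ ys {xs} →
             All (λ x → Any (R x) ys) xs →
             AllPairs (λ x x′ → ∀ {y} → y ∈ ys → R x y → R x′ y → ⊥) xs →
             length xs ≤ length ys
pigeonhole R? [] [] _ = z≤n
pigeonhole R? [] (() ∷ _) _
pigeonhole {R = R} R? (y ∷ ys) {xs} covered disjoint = begin
  length xs                     ≡⟨ length-filter-split (λ x → R? x y) xs ⟩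
  length hits + length misses   ≤⟨ +-mono-≤ (at-most-one (All.all-filter _ xs) (AllPairs.filter⁺ _ disjoint))
                                           (pigeonhole R? ys misses-covered misses-disjoint) ⟩
  1 + length ys                 ∎
  where
  open ≤-Reasoning
  hits misses : List _
  hits = filter (λ x → R? x y) xs
  misses = filter (λ x → ¬? (R? x y)) xs
  at-most-one : ∀ {zs} → All (λ x → R x y) zs →
                AllPairs (λ x x′ → ∀ {z} → z ∈ y ∷ ys → R x z → R x′ z → ⊥) zs → length zs ≤ 1
  at-most-one [] _ = z≤n
  at-most-one (_ ∷ []) _ = ≤-refl
  at-most-one (Rx ∷ Rx′ ∷ _) ((disjoint-xx′ ∷ _) ∷ _) = ⊥-elim (disjoint-xx′ (here refl) Rx Rx′)
  misses-covered : All (λ x → Any (R x) ys) misses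
  misses-covered =
    All.map (λ (any , ¬R) → Any.tail ¬R any) (All.zip (All.filter⁺ _ covered , All.all-filter _ xs))
  misses-disjoint : AllPairs (λ x x′ → ∀ {y} → y ∈ ys → R x y → R x′ y → ⊥) misses
  misses-disjoint =
    AllPairs.map (λ disjoint-xx′ {z} z∈ → disjoint-xx′ (there z∈)) (AllPairs.filter⁺ _ disjoint)

-- The summands + 0 and + 1 are the slack of the root of the resulting matching.
closed-bound : ∀ {m n x y} → m ≤ 3 * x + 1 → n ≤ 3 * y + 1 → suc (m + n) ≤ 3 * suc (x + y) + 0
closed-bound {x = x} {y} m≤ n≤ = ≤-trans (s≤s (+-mono-≤ m≤ n≤)) (≤-reflexive (identity x y))
  where
  identity : ∀ x y → suc ((3 * x + 1) + (3 * y + 1)) ≡ 3 * suc (x + y) + 0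
  identity = solve-∀

exposed-bound : ∀ {m n x y} → m ≤ 3 * x + 0 → n ≤ 3 * y + 0 → suc (m + n) ≤ 3 * (x + y) + 1
exposed-bound {x = x} {y} m≤ n≤ = ≤-trans (s≤s (+-mono-≤ m≤ n≤)) (≤-reflexive (identity x y))
  where
  identity : ∀ x y → suc ((3 * x + 0) + (3 * y + 0)) ≡ 3 * (x + y) + 1
  identity = solve-∀

m≤n+1⇒m∸1≤n : ∀ {m} n → m ≤ n + 1 → m ∸ 1 ≤ n
m≤n+1⇒m∸1≤n {m} n m≤n+1 = subst (m ∸ 1 ≤_) (m+n∸n≡m n 1) (∸-monoˡ-≤ 1 m≤n+1)

crosses-sym : ∀ e f → Crosses e f → Crosses f e
crosses-sym _ _ (inj₁ c) = inj₂ c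
crosses-sym _ _ (inj₂ c) = inj₁ c

crosses-irrefl : ∀ e → ¬ Crosses e e
crosses-irrefl _ (inj₁ (a<a , _)) = <-irrefl refl a<a
crosses-irrefl _ (inj₂ (a<a , _)) = <-irrefl refl a<a

edge-< : ∀ {a b} → a < b → edge a b ≡ (a , b)
edge-< a<b = cong₂ _,_ (m≤n⇒m⊓n≡m (<⇒≤ a<b)) (m≤n⇒m⊔n≡n (<⇒≤ a<b))

edge-> : ∀ {a b} → b < a → edge a b ≡ (b , a)
edge-> b<a = cong₂ _,_ (m≥n⇒m⊓n≡n (<⇒≤ b<a)) (m≥n⇒m⊔n≡m (<⇒≤ b<a))

side-noncrossing : ∀ {n} e f → IsSide n e → proj₂ f < n → ¬ Crosses e f
side-noncrossing _ _ (inj₁ (refl , _)) _ (inj₁ (i<c , c<i+1 , _)) = ≤⇒≯ (≤-pred c<i+1) i<c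
side-noncrossing _ _ (inj₁ (refl , _)) _ (inj₂ (_ , i<d , d<i+1)) = ≤⇒≯ (≤-pred d<i+1) i<d
side-noncrossing _ _ (inj₂ (refl , refl)) d<n (inj₁ (_ , _ , j<d)) = ≤⇒≯ (≤-pred d<n) j<d
side-noncrossing _ _ (inj₂ (refl , refl)) _ (inj₂ (() , _))

Outside : ℕ → ℕ → ℕ → Set
Outside v w y = y < v ⊎ w < y

InRange : ℕ → ℕ → Edge → Set
InRange lo hi (p , r) = lo ≤ p × r ≤ hi

in-two-ranges : ∀ {lo m hi p r} → InRange lo m (p , r) → InRange m hi (p , r) → ¬ p < r
in-two-ranges (_ , r≤m) (m≤p , _) p<r = ≤⇒≯ (≤-trans r≤m m≤p) p<r

record Quad : Set where
  constructor quad
  field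
    a b c d : ℕ
    a<b : a < b
    b<c : b < c
    c<d : c < d

data Corner (q : Quad) : ℕ → Set where
  corner-a : Corner q (Quad.a q)
  corner-b : Corner q (Quad.b q)
  corner-c : Corner q (Quad.c q)
  corner-d : Corner q (Quad.d q)

data Side (q : Quad) : Edge → Set where
  side-ab : Side q (Quad.a q , Quad.b q)
  side-bc : Side q (Quad.b q , Quad.c q)
  side-cd : Side q (Quad.c q , Quad.d q)
  side-ad : Side q (Quad.a q , Quad.d q)

-- Consecutive corners, bounding the part of the polygon cut off by a side other than ad.
data Gap (q : Quad) : ℕ → ℕ → Set where
  gap-ab : Gap q (Quad.a q) (Quad.b q)
  gap-bc : Gap q (Quad.b q) (Quad.c q)
  gap-cd : Gap q (Quad.c q) (Quad.d q)

data Diagonal : Set where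
  ac bd : Diagonal

opposite : Diagonal → Diagonal
opposite ac = bd
opposite bd = ac

diagonal : Quad → Diagonal → Edge
diagonal q ac = (Quad.a q , Quad.c q)
diagonal q bd = (Quad.b q , Quad.d q)

Chord : Quad → Edge → Set
Chord q (p , r) = Corner q p × Corner q r × p < r

module _ {q : Quad} where
  open Quad q

  private
    a<c : a < c
    a<c = <-trans a<b b<c

    b<d : b < d
    b<d = <-trans b<c c<d

    a<d : a < d
    a<d = <-trans a<b b<d

  side-chord : ∀ {s} → Side q s → Chord q s
  side-chord side-ab = corner-a , corner-b , a<b
  side-chord side-bc = corner-b , corner-c , b<c
  side-chord side-cd = corner-c , corner-d , c<d
  side-chord side-ad = corner-a , corner-d , a<d

  diagonal-chord : ∀ δ → Chord q (diagonal q δ)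
  diagonal-chord ac = corner-a , corner-c , a<c
  diagonal-chord bd = corner-b , corner-d , b<d

  gap-side : ∀ {lo hi} → Gap q lo hi → Side q (lo , hi)
  gap-side gap-ab = side-ab
  gap-side gap-bc = side-bc
  gap-side gap-cd = side-cd

  corner-range : ∀ {z} → Corner q z → a ≤ z × z ≤ d
  corner-range corner-a = ≤-refl , <⇒≤ a<d
  corner-range corner-b = <⇒≤ a<b , <⇒≤ b<d
  corner-range corner-c = <⇒≤ a<c , <⇒≤ c<d
  corner-range corner-d = <⇒≤ a<d , ≤-refl

  chord-range : ∀ {e} → Chord q e → InRange a d e
  chord-range (p , r , _) = proj₁ (corner-range p) , proj₂ (corner-range r)

  corner-outside-gap : ∀ {lo hi z} → Gap q lo hi → Corner q z → z ≤ lo ⊎ hi ≤ z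
  corner-outside-gap gap-ab corner-a = inj₁ ≤-refl
  corner-outside-gap gap-ab corner-b = inj₂ ≤-refl
  corner-outside-gap gap-ab corner-c = inj₂ (<⇒≤ b<c)
  corner-outside-gap gap-ab corner-d = inj₂ (<⇒≤ b<d)
  corner-outside-gap gap-bc corner-a = inj₁ (<⇒≤ a<b)
  corner-outside-gap gap-bc corner-b = inj₁ ≤-refl
  corner-outside-gap gap-bc corner-c = inj₂ ≤-refl
  corner-outside-gap gap-bc corner-d = inj₂ (<⇒≤ c<d)
  corner-outside-gap gap-cd corner-a = inj₁ (<⇒≤ a<c)
  corner-outside-gap gap-cd corner-b = inj₁ (<⇒≤ b<c)
  corner-outside-gap gap-cd corner-c = inj₁ ≤-refl
  corner-outside-gap gap-cd corner-d = inj₂ ≤-refl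

  chord-in-gap : ∀ {lo hi e} → Gap q lo hi → Chord q e → InRange lo hi e → e ≡ (lo , hi)
  chord-in-gap {lo} {hi} {p , r} g (cp , cr , p<r) (lo≤p , r≤hi) = cong₂ _,_ p≡lo r≡hi
    where
    p≡lo : p ≡ lo
    p≡lo with corner-outside-gap g cp
    ... | inj₁ p≤lo = ≤-antisym p≤lo lo≤p
    ... | inj₂ hi≤p = ⊥-elim (≤⇒≯ (≤-trans r≤hi hi≤p) p<r)
    r≡hi : r ≡ hi
    r≡hi with corner-outside-gap g cr
    ... | inj₁ r≤lo = ⊥-elim (≤⇒≯ (≤-trans r≤lo lo≤p) p<r)
    ... | inj₂ hi≤r = ≤-antisym r≤hi hi≤r

  side≢diagonal : ∀ {s} δ → Side q s → s ≢ diagonal q δ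
  side≢diagonal ac side-ab e = <-irrefl (cong proj₂ e) b<c
  side≢diagonal ac side-bc e = <-irrefl (sym (cong proj₁ e)) a<b
  side≢diagonal ac side-cd e = <-irrefl (sym (cong proj₁ e)) a<c
  side≢diagonal ac side-ad e = <-irrefl (sym (cong proj₂ e)) c<d
  side≢diagonal bd side-ab e = <-irrefl (cong proj₁ e) a<b
  side≢diagonal bd side-bc e = <-irrefl (cong proj₂ e) c<d
  side≢diagonal bd side-cd e = <-irrefl (sym (cong proj₁ e)) b<c
  side≢diagonal bd side-ad e = <-irrefl (cong proj₁ e) a<b

  diagonals-cross : ∀ δ → Crosses (diagonal q δ) (diagonal q (opposite δ))
  diagonals-cross ac = inj₁ (a<b , b<c , c<d)
  diagonals-cross bd = inj₂ (a<b , b<c , c<d)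

  crossing-diagonal-crosses-side : ∀ δ {e} → Crosses e (diagonal q δ) → e ≢ diagonal q (opposite δ) →
                                   Σ Edge λ s → Side q s × Crosses e s
  crossing-diagonal-crosses-side ac (inj₁ (p<a , a<r , r<c)) _ = _ , side-ad , inj₁ (p<a , a<r , <-trans r<c c<d)
  crossing-diagonal-crosses-side ac {p , r} (inj₂ (a<p , p<c , c<r)) e≢bd with <-cmp r d
  ... | tri< r<d _ _ = _ , side-cd , inj₁ (p<c , c<r , r<d)
  ... | tri> _ _ d<r = _ , side-ad , inj₂ (a<p , <-trans p<c c<d , d<r)
  ... | tri≈ _ refl _ with <-cmp p b
  ...   | tri< p<b _ _ = _ , side-ab , inj₂ (a<p , p<b , b<d)
  ...   | tri≈ _ refl _ = ⊥-elim (e≢bd refl)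
  ...   | tri> _ _ b<p = _ , side-bc , inj₂ (b<p , p<c , c<d)
  crossing-diagonal-crosses-side bd (inj₂ (b<p , p<d , d<r)) _ = _ , side-ad , inj₂ (<-trans a<b b<p , p<d , d<r)
  crossing-diagonal-crosses-side bd {p , r} (inj₁ (p<b , b<r , r<d)) e≢ac with <-cmp r c
  ... | tri< r<c _ _ = _ , side-bc , inj₁ (p<b , b<r , r<c)
  ... | tri> _ _ c<r = _ , side-cd , inj₁ (<-trans p<b b<c , c<r , r<d)
  ... | tri≈ _ refl _ with <-cmp p a
  ...   | tri< p<a _ _ = _ , side-ad , inj₁ (p<a , a<c , c<d)
  ...   | tri≈ _ refl _ = ⊥-elim (e≢ac refl)
  ...   | tri> _ _ a<p = _ , side-ab , inj₂ (a<p , p<b , b<c)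

-- The flip of the edge vw with apices x and y: the quadrilateral on v, w, x, y with its corners
-- sorted, together with the diagonal (ac or bd) that is vw.
record Flip : Set where
  constructor flip
  field
    quadrilateral : Quad
    removed : Diagonal

old : Flip → Edge
old (flip q δ) = diagonal q δ

new : Flip → Edge
new (flip q δ) = diagonal q (opposite δ)

FlipSide : Flip → Edge → Set
FlipSide f = Side (Flip.quadrilateral f)

-- The two flipped edges do not lie on a common triangle.
Compatible : Flip → Flip → Set
Compatible f g = ¬ FlipSide f (old g) × ¬ FlipSide g (old f) × old f ≢ old g

record Within (lo hi : ℕ) (f : Flip) : Set where
  constructor within
  field
    lo≤a : lo ≤ Quad.a (Flip.quadrilateral f)
    d≤hi : Quad.d (Flip.quadrilateral f) ≤ hi
    old≢ : old f ≢ (lo , hi)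

old-chord : ∀ f → Chord (Flip.quadrilateral f) (old f)
old-chord (flip q δ) = diagonal-chord δ

chord-within : ∀ {lo hi f e} → Within lo hi f → Chord (Flip.quadrilateral f) e → InRange lo hi e
chord-within (within lo≤a d≤hi _) ch with chord-range ch
... | a≤p , r≤d = ≤-trans lo≤a a≤p , ≤-trans r≤d d≤hi

compatible-in-gap : ∀ f {lo hi g} → Gap (Flip.quadrilateral f) lo hi → Within lo hi g → Compatible f g
compatible-in-gap f@(flip q δ) {g = g} gap w@(within _ _ old≢) =
  (λ s → old≢ (common (side-chord s) (old-chord g))) ,
  (λ s → side≢diagonal δ (gap-side gap) (sym (common (old-chord f) (side-chord s)))) ,
  (λ e → old≢ (common (subst (Chord q) e (old-chord f)) (old-chord g)))
  where
  common : ∀ {e} → Chord q e → Chord (Flip.quadrilateral g) e → e ≡ _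
  common ch ch′ = chord-in-gap gap ch (chord-within w ch′)

compatible-apart : ∀ {lo m hi f g} → Within lo m f → Within m hi g → Compatible f g
compatible-apart {f = f} {g} w w′ =
  (λ s → apart (side-chord s) (old-chord g)) ,
  (λ s → apart (old-chord f) (side-chord s)) ,
  (λ e → apart (old-chord f) (subst (Chord _) (sym e) (old-chord g)))
  where
  apart : ∀ {e} → Chord (Flip.quadrilateral f) e → ¬ Chord (Flip.quadrilateral g) e
  apart ch ch′@(_ , _ , p<r) = in-two-ranges (chord-within w ch) (chord-within w′ ch′) p<r

within-widenʳ : ∀ {lo m hi f} → m < hi → Within lo m f → Within lo hi f
within-widenʳ {f = f} m<hi w@(within lo≤a d≤m _) =
  within lo≤a (≤-trans d≤m (<⇒≤ m<hi)) λ e →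
    ≤⇒≯ (proj₂ (chord-within w (old-chord f))) (subst (λ e → _ < proj₂ e) (sym e) m<hi)

within-widenˡ : ∀ {lo m hi f} → lo < m → Within m hi f → Within lo hi f
within-widenˡ {f = f} lo<m w@(within m≤a d≤hi _) =
  within (≤-trans (<⇒≤ lo<m) m≤a) d≤hi λ e →
    ≤⇒≯ (proj₁ (chord-within w (old-chord f))) (subst (λ e → proj₁ e < _) (sym e) lo<m)

crossing-old-crosses-side : ∀ f {e} → Crosses e (old f) → e ≢ new f →
                            Σ Edge λ s → FlipSide f s × Crosses e s
crossing-old-crosses-side (flip q δ) = crossing-diagonal-crosses-side δ

crossing-new-crosses-side : ∀ f {e} → Crosses e (new f) → e ≢ old f →
                            Σ Edge λ s → FlipSide f s × Crosses e s
crossing-new-crosses-side (flip q ac) = crossing-diagonal-crosses-side bd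
crossing-new-crosses-side (flip q bd) = crossing-diagonal-crosses-side ac

quad-diagonal-isDiagonal : ∀ {n} q δ → Quad.d q < n → IsDiagonal n (diagonal q δ)
quad-diagonal-isDiagonal (quad a b c d a<b b<c c<d) ac d<n =
  <-trans a<b b<c , <-trans c<d d<n , not-side
  where
  not-side : ¬ IsSide _ (a , c)
  not-side (inj₁ (refl , _)) = ≤⇒≯ a<b b<c
  not-side (inj₂ (_ , refl)) = ≤⇒≯ c<d d<n
quad-diagonal-isDiagonal (quad a b c d a<b b<c c<d) bd d<n = <-trans b<c c<d , d<n , not-side
  where
  not-side : ¬ IsSide _ (b , d)
  not-side (inj₁ (refl , _)) = ≤⇒≯ b<c c<d
  not-side (inj₂ (refl , _)) = ≤⇒≯ z≤n a<b

toPair : Flip → Edge × Edge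
toPair f = old f , new f

TriangleEdge : ℕ × ℕ × ℕ → Edge → Set
TriangleEdge (p , q , r) e = e ≡ (p , q) ⊎ e ≡ (q , r) ⊎ e ≡ (p , r)

triangleEdge? : ∀ t e → Dec (TriangleEdge t e)
triangleEdge? (p , q , r) e = (e ≟E (p , q)) ⊎-dec ((e ≟E (q , r)) ⊎-dec (e ≟E (p , r)))

-- Flips in a maximal outerplane graph

module MaximalOuterplane {n : ℕ} {D : List Edge} (maximal : IsMaxOuterplane n D) where

  _∈G : Edge → Set
  e ∈G = IsEdge n D e

  D-diagonals : All (IsDiagonal n) D
  D-diagonals = proj₁ (proj₁ (proj₂ maximal))

  D-unique : Unique D
  D-unique = proj₁ (proj₂ (proj₁ (proj₂ maximal)))

  D-noncrossing : AllPairs (λ e f → ¬ Crosses e f) D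
  D-noncrossing = proj₂ (proj₂ (proj₁ (proj₂ maximal)))

  ∈G-ordered : ∀ {e} → e ∈G → proj₁ e < proj₂ e × proj₂ e < n
  ∈G-ordered (inj₁ (inj₁ (refl , j<n))) = ≤-refl , j<n
  ∈G-ordered (inj₁ (inj₂ (refl , refl))) = ≤-trans (s≤s z≤n) (≤-pred (proj₁ maximal)) , ≤-refl
  ∈G-ordered (inj₂ e∈D) = proj₁ (All.lookup D-diagonals e∈D) , proj₁ (proj₂ (All.lookup D-diagonals e∈D))

  ∈G-noncrossing : ∀ {e f} → e ∈G → f ∈G → ¬ Crosses e f
  ∈G-noncrossing {e} {f} (inj₁ side) f∈G = side-noncrossing e f side (proj₂ (∈G-ordered f∈G))
  ∈G-noncrossing {e} {f} e∈G (inj₁ side) c =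
    side-noncrossing f e side (proj₂ (∈G-ordered e∈G)) (crosses-sym e f c)
  ∈G-noncrossing {e} {f} (inj₂ e∈D) (inj₂ f∈D) c with allPairs-lookup D-noncrossing e∈D f∈D
  ... | inj₁ refl = crosses-irrefl e c
  ... | inj₂ (inj₁ nc) = nc c
  ... | inj₂ (inj₂ nc) = nc (crosses-sym e f c)

  ∈G-diagonal⇒∈D : ∀ {e} → e ∈G → IsDiagonal n e → e ∈ D
  ∈G-diagonal⇒∈D (inj₁ side) (_ , _ , not-side) = ⊥-elim (not-side side)
  ∈G-diagonal⇒∈D (inj₂ e∈D) _ = e∈D

  record ValidFlip (f : Flip) : Set where
    field
      old∈G : old f ∈G
      sides∈G : ∀ {s} → FlipSide f s → s ∈G
      d<n : Quad.d (Flip.quadrilateral f) < n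

  open ValidFlip

  module _ {f : Flip} (valid : ValidFlip f) where
    private
      q : Quad
      q = Flip.quadrilateral f
      δ : Diagonal
      δ = Flip.removed f

    old-isDiagonal : IsDiagonal n (old f)
    old-isDiagonal = quad-diagonal-isDiagonal q δ (d<n valid)

    new-isDiagonal : IsDiagonal n (new f)
    new-isDiagonal = quad-diagonal-isDiagonal q (opposite δ) (d<n valid)

    old∈D : old f ∈ D
    old∈D = ∈G-diagonal⇒∈D (old∈G valid) old-isDiagonal

    old-crosses-new : Crosses (old f) (new f)
    old-crosses-new = diagonals-cross δ

    new∉D : new f ∉ D
    new∉D new∈D = ∈G-noncrossing (old∈G valid) (inj₂ new∈D) old-crosses-new

    new-noncrossing : ∀ {h} → h ∈G → h ≢ old f → ¬ Crosses h (new f)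
    new-noncrossing h∈G h≢old c with crossing-new-crosses-side f c h≢old
    ... | s , side , cs = ∈G-noncrossing h∈G (sides∈G valid side) cs

  module _ {f g : Flip} (valid-f : ValidFlip f) (valid-g : ValidFlip g) (compatible : Compatible f g) where

    new-edges-noncrossing : ¬ Crosses (new f) (new g)
    new-edges-noncrossing c
      with crossing-new-crosses-side g c (λ e → new∉D valid-f (subst (_∈ D) (sym e) (old∈D valid-g)))
    ... | s , side , cs =
      new-noncrossing valid-f (sides∈G valid-g side) (λ e → proj₁ (proj₂ compatible) (subst (FlipSide g) e side))
        (crosses-sym (new f) s cs)

    new-edges-distinct : new f ≢ new g
    new-edges-distinct e =
      new-noncrossing valid-g (old∈G valid-f) (proj₂ (proj₂ compatible))
        (subst (Crosses (old f)) e (old-crosses-new valid-f))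

  validFlip⇒flipOf : ∀ {f} → ValidFlip f → FlipOf n D (old f) (new f)
  validFlip⇒flipOf {flip (quad a b c d a<b b<c c<d) ac} valid =
    b , d , (a<b , b<c) , inj₂ (c<d , d<n valid) ,
    subst _∈G (sym (edge-< a<b)) (sides∈G valid side-ab) ,
    subst _∈G (sym (edge-< b<c)) (sides∈G valid side-bc) ,
    subst _∈G (sym (edge-< (<-trans a<b (<-trans b<c c<d)))) (sides∈G valid side-ad) ,
    subst _∈G (sym (edge-> c<d)) (sides∈G valid side-cd) ,
    sym (edge-< (<-trans b<c c<d))
  validFlip⇒flipOf {flip (quad a b c d a<b b<c c<d) bd} valid =
    c , a , (b<c , c<d) , inj₁ a<b ,
    subst _∈G (sym (edge-< b<c)) (sides∈G valid side-bc) ,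
    subst _∈G (sym (edge-< c<d)) (sides∈G valid side-cd) ,
    subst _∈G (sym (edge-> a<b)) (sides∈G valid side-ab) ,
    subst _∈G (sym (edge-< (<-trans a<b (<-trans b<c c<d)))) (sides∈G valid side-ad) ,
    sym (edge-> (<-trans a<b b<c))

  module _ {F : List Flip} (valid : All ValidFlip F) (compatible : AllPairs Compatible F) where
    private
      S kept added : List Edge
      S = FlipSet (map toPair F)
      kept = filter (λ e → ¬? (e ∈? S)) D
      added = map proj₂ (map toPair F)

      ∈S⁻ : ∀ {e} → e ∈ S → Σ Flip λ f → f ∈ F × e ≡ old f
      ∈S⁻ e∈ with ∈-map⁻ proj₁ e∈
      ... | _ , p∈ , refl with ∈-map⁻ toPair p∈
      ...   | f , f∈ , refl = f , f∈ , refl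

      ∈S⁺ : ∀ {f} → f ∈ F → old f ∈ S
      ∈S⁺ f∈ = ∈-map⁺ proj₁ (∈-map⁺ toPair f∈)

      ∈added⁻ : ∀ {e} → e ∈ added → Σ Flip λ f → f ∈ F × e ≡ new f
      ∈added⁻ e∈ with ∈-map⁻ proj₂ e∈
      ... | _ , p∈ , refl with ∈-map⁻ toPair p∈
      ...   | f , f∈ , refl = f , f∈ , refl

      ∈added⁺ : ∀ {f} → f ∈ F → new f ∈ kept ++ added
      ∈added⁺ f∈ = ∈-++⁺ʳ kept (∈-map⁺ proj₂ (∈-map⁺ toPair f∈))

      ∈kept⁻ : ∀ {e} → e ∈ kept → e ∈ D × e ∉ S
      ∈kept⁻ = ∈-filter⁻ (λ e → ¬? (e ∈? S))

      ∈kept⁺ : ∀ {e} → e ∈ D → e ∉ S → e ∈ kept ++ added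
      ∈kept⁺ e∈D e∉S = ∈-++⁺ˡ (∈-filter⁺ (λ e → ¬? (e ∈? S)) e∈D e∉S)

      valid-at : ∀ {f} → f ∈ F → ValidFlip f
      valid-at = All.lookup valid

      kept-added-noncrossing : All (λ k → All (λ e → ¬ Crosses k e) added) kept
      kept-added-noncrossing = All.tabulate λ k∈ → All.tabulate λ e∈ → noncrossing k∈ e∈
        where
        noncrossing : ∀ {k e} → k ∈ kept → e ∈ added → ¬ Crosses k e
        noncrossing k∈ e∈ with ∈kept⁻ k∈ | ∈added⁻ e∈
        ... | k∈D , k∉S | f , f∈ , refl =
          new-noncrossing (valid-at f∈) (inj₂ k∈D) (λ { refl → k∉S (∈S⁺ f∈) })

      sides-kept : ∀ {f s} → f ∈ F → FlipSide f s → s ∉ S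
      sides-kept f∈ side s∈S with ∈S⁻ s∈S
      ... | f′ , f′∈ , refl with allPairs-lookup compatible f∈ f′∈
      ...   | inj₁ refl = side≢diagonal _ side refl
      ...   | inj₂ (inj₁ compat) = proj₁ compat side
      ...   | inj₂ (inj₂ compat) = proj₁ (proj₂ compat) side

      -- A diagonal crossing a flipped edge crosses a side of its quadrilateral, and sides are kept.
      crossing-kept-or-added : ∀ {g h} → IsDiagonal n g → g ∉ kept ++ added → h ∈ D → Crosses g h →
                               Σ Edge λ h′ → h′ ∈ kept ++ added × Crosses g h′
      crossing-kept-or-added {g} {h} g-diag g∉ h∈D c with h ∈? S
      ... | no h∉S = h , ∈kept⁺ h∈D h∉S , c
      ... | yes h∈S with ∈S⁻ h∈S
      ...   | f , f∈ , refl with crossing-old-crosses-side f c (λ { refl → g∉ (∈added⁺ f∈) })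
      ...     | s , side , cs with sides∈G (valid-at f∈) side
      ...       | inj₁ polygon-side =
        ⊥-elim (side-noncrossing s g polygon-side (proj₁ (proj₂ g-diag)) (crosses-sym g s cs))
      ...       | inj₂ s∈D = s , ∈kept⁺ s∈D (sides-kept f∈ side) , cs

    compatible-flippable : Flippable n D (map toPair F)
    compatible-flippable =
      All.map⁺ (All.map (λ v → old∈D v , validFlip⇒flipOf v) valid) ,
      AllPairs.map⁺ (AllPairs.map⁺ (AllPairs.map (λ c → proj₂ (proj₂ c)) compatible)) ,
      proj₁ maximal ,
      (All.++⁺ (All.filter⁺ _ D-diagonals) (All.map⁺ (All.map⁺ (All.map new-isDiagonal valid))) ,
       Unique.++⁺ (Unique.filter⁺ _ D-unique) added-unique kept-added-disjoint ,
       AllPairs.++⁺ (AllPairs.filter⁺ _ D-noncrossing) added-noncrossing kept-added-noncrossing) ,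
      maximality
      where
      added-unique : Unique added
      added-unique = AllPairs.map⁺ (AllPairs.map⁺ (allPairs-map-with new-edges-distinct valid compatible))
      added-noncrossing : AllPairs (λ e f → ¬ Crosses e f) added
      added-noncrossing = AllPairs.map⁺ (AllPairs.map⁺ (allPairs-map-with new-edges-noncrossing valid compatible))
      kept-added-disjoint : ∀ {e} → ¬ (e ∈ kept × e ∈ added)
      kept-added-disjoint (k∈ , e∈) with ∈added⁻ e∈
      ... | f , f∈ , refl = new∉D (valid-at f∈) (proj₁ (∈kept⁻ k∈))
      maximality : (g : Edge) → IsDiagonal n g → g ∉ kept ++ added →
                   Σ Edge λ h → h ∈ kept ++ added × (Crosses g h ⊎ Crosses h g)
      maximality g g-diag g∉ with g ∈? D
      ... | yes g∈D with g ∈? S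
      ...   | no g∉S = ⊥-elim (g∉ (∈kept⁺ g∈D g∉S))
      ...   | yes g∈S with ∈S⁻ g∈S
      ...     | f , f∈ , refl = new f , ∈added⁺ f∈ , inj₁ (old-crosses-new (valid-at f∈))
      maximality g g-diag g∉ | no g∉D with proj₂ (proj₂ maximal) g g-diag g∉D
      ... | h , h∈D , c with crossing-kept-or-added g-diag g∉ h∈D ([ id , crosses-sym h g ]′ c)
      ...   | h′ , h′∈ , c′ = h′ , h′∈ , inj₁ c′

  -- The dual tree and a greedy matching

  _∈G? : ∀ e → Dec (e ∈G)
  (i , j) ∈G? = (((suc i ≟ j) ×-dec (j <? n)) ⊎-dec ((i ≟ 0) ×-dec (suc j ≟ n))) ⊎-dec ((i , j) ∈? D)

  farthest-neighbour : ∀ a i → a < i → i < n →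
                       Σ ℕ λ k → a < k × k ≤ i × (a , k) ∈G × (∀ c → k < c → c ≤ i → ¬ (a , c) ∈G)
  farthest-neighbour a (suc i) a<1+i 1+i<n with (a , suc i) ∈G?
  ... | yes a-i = suc i , a<1+i , ≤-refl , a-i , λ c i<c c≤i → ⊥-elim (≤⇒≯ c≤i i<c)
  ... | no ¬a-i with m≤n⇒m<n∨m≡n (≤-pred a<1+i)
  ...   | inj₂ refl = ⊥-elim (¬a-i (inj₁ (inj₁ (refl , 1+i<n))))
  ...   | inj₁ a<i with farthest-neighbour a i a<i (<-trans (n<1+n i) 1+i<n)
  ...     | k , a<k , k≤i , a-k , farthest = k , a<k , m≤n⇒m≤1+n k≤i , a-k , farthest′
    where
    farthest′ : ∀ c → k < c → c ≤ suc i → ¬ (a , c) ∈G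
    farthest′ c k<c c≤1+i with m≤n⇒m<n∨m≡n c≤1+i
    ... | inj₁ c<1+i = farthest c k<c (≤-pred c<1+i)
    ... | inj₂ refl = ¬a-i

  -- k is the farthest neighbour of a before b: a diagonal crossing kb would cross ab or ak, or
  -- end at a neighbour of a beyond k.
  apex : ∀ {a b} → (a , b) ∈G → suc a < b → Σ ℕ λ k → a < k × k < b × (a , k) ∈G × (k , b) ∈G
  apex {a} {suc i} a-b 1+a<b with farthest-neighbour a i (≤-pred 1+a<b) (<-trans (n<1+n i) (proj₂ (∈G-ordered a-b)))
  ... | k , a<k , k≤i , a-k , farthest with m≤n⇒m<n∨m≡n k≤i
  ...   | inj₂ refl = k , a<k , s≤s k≤i , a-k , inj₁ (inj₁ (refl , proj₂ (∈G-ordered a-b)))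
  ...   | inj₁ k<i with (k , suc i) ∈G?
  ...     | yes k-b = k , a<k , s≤s k≤i , a-k , k-b
  ...     | no ¬k-b = ⊥-elim contradiction
    where
    k-b-diagonal : IsDiagonal n (k , suc i)
    k-b-diagonal = s≤s k≤i , proj₂ (∈G-ordered a-b) , λ side → ¬k-b (inj₁ side)
    contradiction : ⊥
    contradiction with proj₂ (proj₂ maximal) (k , suc i) k-b-diagonal (λ k-b∈D → ¬k-b (inj₂ k-b∈D))
    ... | (c , d) , cd∈D , crossing with [ crosses-sym (k , suc i) (c , d) , id ]′ crossing
    ...   | inj₂ (k<c , c<b , b<d) = ∈G-noncrossing a-b (inj₂ cd∈D) (inj₁ (<-trans a<k k<c , c<b , b<d))
    ...   | inj₁ (c<k , k<d , d<b) with <-cmp c a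
    ...     | tri< c<a _ _ = ∈G-noncrossing (inj₂ cd∈D) a-b (inj₁ (c<a , <-trans a<k k<d , d<b))
    ...     | tri≈ _ refl _ = farthest d k<d (≤-pred d<b) (inj₂ cd∈D)
    ...     | tri> _ _ a<c = ∈G-noncrossing a-k (inj₂ cd∈D) (inj₁ (a<c , c<k , k<d))

  data Triangulation : ℕ → ℕ → Set where
    side : ∀ {a} → Triangulation a (suc a)
    triangle : ∀ {a b} k → a < k → k < b → (a , k) ∈G → (k , b) ∈G →
               Triangulation a k → Triangulation k b → Triangulation a b

  triangulation : ∀ {a b} → (a , b) ∈G → Triangulation a b
  triangulation {a} {b} a-b = bounded b (m≤n+m b a) a-b
    where
    bounded : ∀ fuel {a b} → b ≤ a + fuel → (a , b) ∈G → Triangulation a b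
    bounded fuel {a} {b} b≤a+fuel a-b with suc a ≟ b
    ... | yes refl = side
    ... | no 1+a≢b with fuel | apex a-b (≤∧≢⇒< (proj₁ (∈G-ordered a-b)) 1+a≢b)
    ...   | zero | _ = ⊥-elim (≤⇒≯ (subst (b ≤_) (+-identityʳ a) b≤a+fuel) (proj₁ (∈G-ordered a-b)))
    ...   | suc fuel′ | k , a<k , k<b , a-k , k-b =
      triangle k a<k k<b a-k k-b
        (bounded fuel′ (≤-pred (subst (k <_) (+-suc a fuel′) (<-≤-trans k<b b≤a+fuel))) a-k)
        (bounded fuel′ (≤-trans b≤a+fuel (subst (_≤ k + fuel′) (sym (+-suc a fuel′)) (+-monoˡ-≤ fuel′ a<k)))
                 k-b)

  triangles : ∀ {a b} → Triangulation a b → ℕ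
  triangles side = 0
  triangles (triangle _ _ _ _ _ L R) = suc (triangles L + triangles R)

  triangles-count : ∀ {a b} (t : Triangulation a b) → suc (a + triangles t) ≡ b
  triangles-count {a} side = cong suc (+-identityʳ a)
  triangles-count {a} {b} (triangle k _ _ _ _ L R) = begin
    suc (a + suc (triangles L + triangles R))   ≡⟨ cong suc (+-suc a _) ⟩
    suc (suc (a + (triangles L + triangles R))) ≡⟨ cong (suc ∘ suc) (+-assoc a _ _) ⟨
    suc (suc (a + triangles L + triangles R))   ≡⟨ cong (λ m → suc (m + triangles R)) (triangles-count L) ⟩
    suc (k + triangles R)                       ≡⟨ triangles-count R ⟩
    b                                           ∎
    where open ≡-Reasoning

  record CompatibleSet (lo hi : ℕ) (F : List Flip) : Set where
    constructor compatibleSet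
    field
      all-valid : All ValidFlip F
      pairwise-compatible : AllPairs Compatible F
      all-within : All (Within lo hi) F

  compatibleSet-++ : ∀ {a k b F F′} → a < k → k < b → CompatibleSet a k F → CompatibleSet k b F′ →
                     CompatibleSet a b (F ++ F′)
  compatibleSet-++ a<k k<b (compatibleSet vF cF wF) (compatibleSet vF′ cF′ wF′) = compatibleSet
    (All.++⁺ vF vF′)
    (AllPairs.++⁺ cF cF′ (All.map (λ w → All.map (compatible-apart w) wF′) wF))
    (All.++⁺ (All.map (within-widenʳ k<b) wF) (All.map (within-widenˡ a<k) wF′))

  compatibleSet-∷ : ∀ {a b f F} → ValidFlip f → Within a b f → All (Compatible f) F → CompatibleSet a b F →
                    CompatibleSet a b (f ∷ F)
  compatibleSet-∷ vf wf cf (compatibleSet vF cF wF) = compatibleSet (vf ∷ vF) (cf ∷ cF) (wf ∷ wF)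

  -- The root triangle (a , j , b) is exposed when no flip of F removes aj or jb, so that the
  -- parent triangle can still be matched with it.
  data Root (a b : ℕ) (F : List Flip) : Set where
    closed : Root a b F
    exposed : ∀ j → a < j → j < b → (a , j) ∈G → (j , b) ∈G →
              All (λ g → Within a j g ⊎ Within j b g) F → Root a b F

  slack : ∀ {a b F} → Root a b F → ℕ
  slack closed = 0
  slack (exposed _ _ _ _ _ _) = 1

  slack≤1 : ∀ {a b F} (r : Root a b F) → slack r ≤ 1
  slack≤1 closed = z≤n
  slack≤1 (exposed _ _ _ _ _ _) = ≤-refl

  record Matching (a b N : ℕ) : Set where
    constructor matching
    field
      flips : List Flip
      compatible-flips : CompatibleSet a b flips
      root : Root a b flips
      bound : N ≤ 3 * length flips + slack root

  matching-bound : ∀ {a b N} (M : Matching a b N) → N ≤ 3 * length (Matching.flips M) + 1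
  matching-bound (matching F _ r bound) = ≤-trans bound (+-monoʳ-≤ (3 * length F) (slack≤1 r))

  -- Match the triangle (a , k , b) with an exposed child by flipping their common edge; if neither
  -- child is exposed, leave (a , k , b) exposed.
  join : ∀ {a k b NL NR} → a < k → k < b → (a , b) ∈G → (a , k) ∈G → (k , b) ∈G →
         Matching a k NL → Matching k b NR → Matching a b (suc (NL + NR))
  join {a} {k} {b} a<k k<b a-b a-k k-b
       (matching FL setL (exposed j a<j j<k a-j j-k inL) boundL) MR@(matching FR setR _ _) =
    matching (f ∷ FL ++ FR) (compatibleSet-∷ valid within-ab compatible (compatibleSet-++ a<k k<b setL setR)) closed
      (subst (λ m → _ ≤ 3 * suc m + 0) (sym (length-++ FL)) (closed-bound {x = length FL} boundL (matching-bound MR)))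
    where
    f : Flip
    f = flip (quad a j k b a<j j<k k<b) ac
    valid : ValidFlip f
    valid = record { old∈G = a-k ; sides∈G = λ { side-ab → a-j ; side-bc → j-k ; side-cd → k-b ; side-ad → a-b }
                   ; d<n = proj₂ (∈G-ordered a-b) }
    within-ab : Within a b f
    within-ab = within ≤-refl ≤-refl λ e → <-irrefl (cong proj₂ e) k<b
    compatible : All (Compatible f) (FL ++ FR)
    compatible = All.++⁺ (All.map [ compatible-in-gap f gap-ab , compatible-in-gap f gap-bc ]′ inL)
                         (All.map (compatible-in-gap f gap-cd) (CompatibleSet.all-within setR))
  join {a} {k} {b} a<k k<b a-b a-k k-b
       ML@(matching FL setL closed _) (matching FR setR (exposed j k<j j<b k-j j-b inR) boundR) =
    matching (f ∷ FL ++ FR) (compatibleSet-∷ valid within-ab compatible (compatibleSet-++ a<k k<b setL setR)) closed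
      (subst (λ m → _ ≤ 3 * suc m + 0) (sym (length-++ FL)) (closed-bound {x = length FL} (matching-bound ML) boundR))
    where
    f : Flip
    f = flip (quad a k j b a<k k<j j<b) bd
    valid : ValidFlip f
    valid = record { old∈G = k-b ; sides∈G = λ { side-ab → a-k ; side-bc → k-j ; side-cd → j-b ; side-ad → a-b }
                   ; d<n = proj₂ (∈G-ordered a-b) }
    within-ab : Within a b f
    within-ab = within ≤-refl ≤-refl λ e → <-irrefl (sym (cong proj₁ e)) a<k
    compatible : All (Compatible f) (FL ++ FR)
    compatible = All.++⁺ (All.map (compatible-in-gap f gap-ab) (CompatibleSet.all-within setL))
                         (All.map [ compatible-in-gap f gap-bc , compatible-in-gap f gap-cd ]′ inR)
  join a<k k<b a-b a-k k-b (matching FL setL closed boundL) (matching FR setR closed boundR) =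
    matching (FL ++ FR) (compatibleSet-++ a<k k<b setL setR)
      (exposed _ a<k k<b a-k k-b (All.++⁺ (All.map inj₁ (CompatibleSet.all-within setL))
                                           (All.map inj₂ (CompatibleSet.all-within setR))))
      (subst (λ m → _ ≤ 3 * m + 1) (sym (length-++ FL)) (exposed-bound {x = length FL} boundL boundR))

  greedy-matching : ∀ {a b} (t : Triangulation a b) → (a , b) ∈G → Matching a b (triangles t)
  greedy-matching side _ = matching [] (compatibleSet [] [] []) closed z≤n
  greedy-matching (triangle k a<k k<b a-k k-b L R) a-b =
    join a<k k<b a-b a-k k-b (greedy-matching L a-k) (greedy-matching R k-b)

  -- Flips of the edges of a triangle

  edge-<-∈G : ∀ {x y} → x < y → edge x y ∈G → (x , y) ∈G
  edge-<-∈G x<y = subst _∈G (edge-< x<y)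

  edge->-∈G : ∀ {x y} → y < x → edge x y ∈G → (y , x) ∈G
  edge->-∈G y<x = subst _∈G (edge-> y<x)

  inner-apex-unique : ∀ {v w x x′} → v < x → x < w → v < x′ → x′ < w →
                      edge v x ∈G → edge x w ∈G → edge v x′ ∈G → edge x′ w ∈G → x ≡ x′
  inner-apex-unique {x = x} {x′} v<x x<w v<x′ x′<w v-x x-w v-x′ x′-w with <-cmp x x′
  ... | tri< x<x′ _ _ =
    ⊥-elim (∈G-noncrossing (edge-<-∈G v<x′ v-x′) (edge-<-∈G x<w x-w) (inj₁ (v<x , x<x′ , x′<w)))
  ... | tri≈ _ x≡x′ _ = x≡x′
  ... | tri> _ _ x′<x =
    ⊥-elim (∈G-noncrossing (edge-<-∈G v<x v-x) (edge-<-∈G x′<w x′-w) (inj₁ (v<x′ , x′<x , x<w)))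

  private
    outer-apices-unordered : ∀ {v w y z} → v < w → Outside v w y → Outside v w z → y < z →
                             edge v y ∈G → edge y w ∈G → edge v z ∈G → edge z w ∈G → ⊥
    outer-apices-unordered v<w (inj₁ y<v) (inj₁ z<v) y<z v-y _ _ z-w =
      ∈G-noncrossing (edge->-∈G y<v v-y) (edge-<-∈G (<-trans z<v v<w) z-w) (inj₁ (y<z , z<v , v<w))
    outer-apices-unordered v<w (inj₁ y<v) (inj₂ w<z) _ _ y-w v-z _ =
      ∈G-noncrossing (edge-<-∈G (<-trans y<v v<w) y-w) (edge-<-∈G (<-trans v<w w<z) v-z) (inj₁ (y<v , v<w , w<z))
    outer-apices-unordered v<w (inj₂ w<y) (inj₁ z<v) y<z _ _ _ _ =
      <-asym (<-trans z<v (<-trans v<w w<y)) y<z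
    outer-apices-unordered v<w (inj₂ w<y) (inj₂ w<z) y<z v-y _ _ z-w =
      ∈G-noncrossing (edge-<-∈G (<-trans v<w w<y) v-y) (edge->-∈G w<z z-w) (inj₁ (v<w , w<y , y<z))

  outer-apex-unique : ∀ {v w y z} → v < w → Outside v w y → Outside v w z →
                      edge v y ∈G → edge y w ∈G → edge v z ∈G → edge z w ∈G → y ≡ z
  outer-apex-unique {y = y} {z} v<w out-y out-z v-y y-w v-z z-w with <-cmp y z
  ... | tri< y<z _ _ = ⊥-elim (outer-apices-unordered v<w out-y out-z y<z v-y y-w v-z z-w)
  ... | tri≈ _ y≡z _ = y≡z
  ... | tri> _ _ z<y = ⊥-elim (outer-apices-unordered v<w out-z out-y z<y v-z z-w v-y y-w)

  record IsTriangle (p q r : ℕ) : Set where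
    constructor is-triangle
    field
      p<q : p < q
      q<r : q < r
      p-q : (p , q) ∈G
      q-r : (q , r) ∈G
      p-r : (p , r) ∈G

  module _ {p q r : ℕ} (T : IsTriangle p q r) where
    open IsTriangle T
    private
      p<r : p < r
      p<r = <-trans p<q q<r
      outside : ∀ {v w y} → y < v ⊎ (w < y × y < n) → Outside v w y
      outside = [ inj₁ , inj₂ ∘ proj₁ ]′

    -- Apices are unique, so the flip of an edge of the triangle uses its opposite corner.
    flip-of-pq : ∀ {e′} → FlipOf n D (p , q) e′ → Σ ℕ λ x → p < x × x < q × e′ ≡ (x , r)
    flip-of-pq (x , y , (p<x , x<q) , out , _ , _ , p-y , y-q , refl) =
      x , p<x , x<q , trans (cong (edge x) y≡r) (edge-< (<-trans x<q q<r))
      where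
      y≡r : y ≡ r
      y≡r = outer-apex-unique p<q (outside out) (inj₂ q<r) p-y y-q
              (subst _∈G (sym (edge-< p<r)) p-r) (subst _∈G (sym (edge-> q<r)) q-r)

    flip-of-qr : ∀ {e′} → FlipOf n D (q , r) e′ → Σ ℕ λ x → q < x × x < r × e′ ≡ (p , x)
    flip-of-qr (x , y , (q<x , x<r) , out , _ , _ , q-y , y-r , refl) =
      x , q<x , x<r , trans (cong (edge x) y≡p) (edge-> (<-trans p<q q<x))
      where
      y≡p : y ≡ p
      y≡p = outer-apex-unique q<r (outside out) (inj₁ p<q) q-y y-r
              (subst _∈G (sym (edge-> p<q)) p-q) (subst _∈G (sym (edge-< p<r)) p-r)

    flip-of-pr : ∀ {e′} → FlipOf n D (p , r) e′ → Σ ℕ λ y → Outside p r y × e′ ≡ edge q y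
    flip-of-pr (x , y , (p<x , x<r) , out , p-x , x-r , _ , _ , refl) =
      y , outside out , cong (λ z → edge z y) x≡q
      where
      x≡q : x ≡ q
      x≡q = inner-apex-unique p<x x<r p<q q<r p-x x-r
              (subst _∈G (sym (edge-< p<q)) p-q) (subst _∈G (sym (edge-< q<r)) q-r)

    private
      pq-qr-flips-cross : ∀ {e′ f′} → FlipOf n D (p , q) e′ → FlipOf n D (q , r) f′ → Crosses e′ f′
      pq-qr-flips-cross φ ψ with flip-of-pq φ | flip-of-qr ψ
      ... | x , p<x , x<q , refl | x′ , q<x′ , x′<r , refl = inj₂ (p<x , <-trans x<q q<x′ , x′<r)

      pq-pr-flips-cross : ∀ {e′ f′} → FlipOf n D (p , q) e′ → FlipOf n D (p , r) f′ → Crosses e′ f′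
      pq-pr-flips-cross φ ψ with flip-of-pq φ | flip-of-pr ψ
      ... | x , p<x , x<q , refl | y , inj₁ y<p , refl =
        subst (Crosses _) (sym (edge-> (<-trans y<p p<q))) (inj₂ (<-trans y<p p<x , x<q , q<r))
      ... | x , p<x , x<q , refl | y , inj₂ r<y , refl =
        subst (Crosses _) (sym (edge-< (<-trans q<r r<y))) (inj₁ (x<q , q<r , r<y))

      qr-pr-flips-cross : ∀ {e′ f′} → FlipOf n D (q , r) e′ → FlipOf n D (p , r) f′ → Crosses e′ f′
      qr-pr-flips-cross φ ψ with flip-of-qr φ | flip-of-pr ψ
      ... | x , q<x , x<r , refl | y , inj₁ y<p , refl =
        subst (Crosses _) (sym (edge-> (<-trans y<p p<q))) (inj₂ (y<p , p<q , q<x))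
      ... | x , q<x , x<r , refl | y , inj₂ r<y , refl =
        subst (Crosses _) (sym (edge-< (<-trans q<r r<y))) (inj₁ (p<q , q<x , <-trans x<r r<y))

    triangle-flips-cross : ∀ {e f e′ f′} → TriangleEdge (p , q , r) e → TriangleEdge (p , q , r) f → e ≢ f →
                           FlipOf n D e e′ → FlipOf n D f f′ → Crosses e′ f′
    triangle-flips-cross (inj₁ refl) (inj₁ refl) e≢f = ⊥-elim (e≢f refl)
    triangle-flips-cross (inj₁ refl) (inj₂ (inj₁ refl)) _ = pq-qr-flips-cross
    triangle-flips-cross (inj₁ refl) (inj₂ (inj₂ refl)) _ = pq-pr-flips-cross
    triangle-flips-cross (inj₂ (inj₁ refl)) (inj₁ refl) _ φ ψ = crosses-sym _ _ (pq-qr-flips-cross ψ φ)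
    triangle-flips-cross (inj₂ (inj₁ refl)) (inj₂ (inj₁ refl)) e≢f = ⊥-elim (e≢f refl)
    triangle-flips-cross (inj₂ (inj₁ refl)) (inj₂ (inj₂ refl)) _ = qr-pr-flips-cross
    triangle-flips-cross (inj₂ (inj₂ refl)) (inj₁ refl) _ φ ψ = crosses-sym _ _ (pq-pr-flips-cross ψ φ)
    triangle-flips-cross (inj₂ (inj₂ refl)) (inj₂ (inj₁ refl)) _ φ ψ = crosses-sym _ _ (qr-pr-flips-cross ψ φ)
    triangle-flips-cross (inj₂ (inj₂ refl)) (inj₂ (inj₂ refl)) e≢f = ⊥-elim (e≢f refl)

  flippable⇒new-edges-noncrossing : ∀ {P} → Flippable n D P → AllPairs (λ e f → ¬ Crosses e f) (map proj₂ P)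
  flippable⇒new-edges-noncrossing {P} (_ , _ , _ , (_ , _ , noncrossing) , _) =
    allPairs-++⁻ʳ (filter (λ e → ¬? (e ∈? FlipSet P)) D) noncrossing

  NoCommonTriangle : Edge → Edge → Set
  NoCommonTriangle e f = ∀ {p q r} → IsTriangle p q r → TriangleEdge (p , q , r) e → TriangleEdge (p , q , r) f → ⊥

  flippable-one-per-triangle : ∀ {P} → Flippable n D P → AllPairs NoCommonTriangle (FlipSet P)
  flippable-one-per-triangle {P} flippable@(flips , unique , _) =
    AllPairs.map⁺ (allPairs-map-with no-common-triangle flips
      (AllPairs.zip (AllPairs.map⁻ unique , AllPairs.map⁻ (flippable⇒new-edges-noncrossing flippable))))
    where
    no-common-triangle : ∀ {φ ψ : Edge × Edge} →
                         proj₁ φ ∈ D × FlipOf n D (proj₁ φ) (proj₂ φ) → proj₁ ψ ∈ D × FlipOf n D (proj₁ ψ) (proj₂ ψ) →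
                         proj₁ φ ≢ proj₁ ψ × ¬ Crosses (proj₂ φ) (proj₂ ψ) → NoCommonTriangle (proj₁ φ) (proj₁ ψ)
    no-common-triangle (_ , flip-φ) (_ , flip-ψ) (distinct , noncrossing) T e-φ e-ψ =
      noncrossing (triangle-flips-cross T e-φ e-ψ distinct flip-φ flip-ψ)

large-flippable-set : (n : ℕ) (D : List Edge) → IsMaxOuterplane n D →
                      Σ (List (Edge × Edge)) λ P → Flippable n D P × n ∸ 3 ≤ 3 * length P
large-flippable-set zero D (() , _)
large-flippable-set (suc j) D maximal =
  map toPair F , compatible-flippable all-valid pairwise-compatible ,
  subst (λ x → suc j ∸ 3 ≤ 3 * x) (sym (length-map toPair F))
    (subst (λ m → suc m ∸ 3 ≤ 3 * length F) (triangles-count t)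
      (m≤n+1⇒m∸1≤n (3 * length F) (matching-bound M)))
  where
  open MaximalOuterplane maximal
  t : Triangulation 0 j
  t = triangulation (inj₁ (inj₂ (refl , refl)))
  M = greedy-matching t (inj₁ (inj₂ (refl , refl)))
  F = Matching.flips M
  open CompatibleSet (Matching.compatible-flips M)

-- Graphs with few simultaneous flips

-- Glue onto the side (0 , m) of the polygon 0, …, m the triangle (0 , m , m + 2) with ears at
-- m + 1 and m + 3.
attachHub : ℕ → List Edge → List Edge
attachHub m D = (0 , m) ∷ (m , 2 + m) ∷ (0 , 2 + m) ∷ D

noncrossing-left-of : ∀ {m i j c d} → d ≤ m → i ≡ 0 ⊎ m ≤ i → m ≤ j → ¬ Crosses (i , j) (c , d)
noncrossing-left-of d≤m _ m≤j (inj₁ (_ , _ , j<d)) = ≤⇒≯ (≤-trans d≤m m≤j) j<d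
noncrossing-left-of d≤m (inj₁ refl) _ (inj₂ (() , _))
noncrossing-left-of d≤m (inj₂ m≤i) _ (inj₂ (_ , i<d , _)) = ≤⇒≯ (≤-trans d≤m m≤i) i<d

module _ {m : ℕ} {D : List Edge} (maximal : IsMaxOuterplane (suc m) D) where
  private
    n : ℕ
    n = 4 + m
    2≤m : 2 ≤ m
    2≤m = ≤-pred (proj₁ maximal)
    0<m : 0 < m
    0<m = ≤-trans (s≤s z≤n) 2≤m
    m<2+m : m < 2 + m
    m<2+m = s≤s (n≤1+n m)
    2+m<n : 2 + m < n
    2+m<n = s≤s (s≤s (s≤s (n≤1+n m)))
    1+m<n : 1 + m < n
    1+m<n = s≤s (s≤s (m≤n+m m 2))
    D-diagonals : All (IsDiagonal (suc m)) D
    D-diagonals = proj₁ (proj₁ (proj₂ maximal))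

    D-below : ∀ {e} → e ∈ D → proj₂ e ≤ m
    D-below e∈D = ≤-pred (proj₁ (proj₂ (All.lookup D-diagonals e∈D)))

    lift : ∀ {e} → IsDiagonal (suc m) e → IsDiagonal n e
    lift (i<j , j<1+m , not-side) = i<j , <-trans j<1+m 1+m<n , not-side′
      where
      not-side′ : ¬ IsSide n _
      not-side′ (inj₁ (e , _)) = not-side (inj₁ (e , j<1+m))
      not-side′ (inj₂ (_ , refl)) = ≤⇒≯ (m≤n+m (suc m) 2) j<1+m

    0-m : IsDiagonal n (0 , m)
    0-m = 0<m , <-trans m<2+m 2+m<n , not-side
      where
      not-side : ¬ IsSide n (0 , m)
      not-side (inj₁ (1≡m , _)) = ≤⇒≯ 2≤m (subst (_< 2) 1≡m ≤-refl)
      not-side (inj₂ (_ , e)) = <-irrefl e 1+m<n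

    m-2+m : IsDiagonal n (m , 2 + m)
    m-2+m = m<2+m , 2+m<n , not-side
      where
      not-side : ¬ IsSide n (m , 2 + m)
      not-side (inj₁ (e , _)) = <-irrefl e (n<1+n (suc m))
      not-side (inj₂ (m≡0 , _)) = <-irrefl (sym m≡0) 0<m

    0-2+m : IsDiagonal n (0 , 2 + m)
    0-2+m = s≤s z≤n , 2+m<n , not-side
      where
      not-side : ¬ IsSide n (0 , 2 + m)
      not-side (inj₁ (() , _))
      not-side (inj₂ (_ , e)) = <-irrefl e (n<1+n (3 + m))

    not-in-D : ∀ {h} → h ∉ D → All (h ≢_) D
    not-in-D h∉D = All.tabulate λ f∈D h≡f → h∉D (subst (_∈ D) (sym h≡f) f∈D)

    unique : AllPairs _≢_ (attachHub m D)
    unique =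
      ((λ e → <-irrefl (cong proj₁ e) 0<m) ∷ (λ e → <-irrefl (cong proj₂ e) m<2+m) ∷ not-in-D 0-m∉D) ∷
      ((λ e → <-irrefl (sym (cong proj₁ e)) 0<m) ∷ not-in-D (above (n≤1+n _))) ∷
      not-in-D (above (n≤1+n _)) ∷
      proj₁ (proj₂ (proj₁ (proj₂ maximal)))
      where
      0-m∉D : (0 , m) ∉ D
      0-m∉D 0-m∈D = proj₂ (proj₂ (All.lookup D-diagonals 0-m∈D)) (inj₂ (refl , refl))
      above : ∀ {i j} → suc m ≤ j → (i , j) ∉ D
      above m<j e∈D = ≤⇒≯ (D-below e∈D) m<j

    noncrossing : AllPairs (λ e f → ¬ Crosses e f) (attachHub m D)
    noncrossing =
      ((λ { (inj₁ (_ , m<m , _)) → <-irrefl refl m<m ; (inj₂ (() , _)) }) ∷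
       (λ { (inj₁ (() , _)) ; (inj₂ (() , _)) }) ∷
       All.tabulate (λ f∈D → noncrossing-left-of (D-below f∈D) (inj₁ refl) ≤-refl)) ∷
      ((λ { (inj₁ (() , _)) ; (inj₂ (_ , _ , m<m)) → <-irrefl refl m<m }) ∷
       All.tabulate (λ f∈D → noncrossing-left-of (D-below f∈D) (inj₂ ≤-refl) (<⇒≤ m<2+m))) ∷
      All.tabulate (λ f∈D → noncrossing-left-of (D-below f∈D) (inj₁ refl) (<⇒≤ m<2+m)) ∷
      proj₂ (proj₂ (proj₁ (proj₂ maximal)))

    position : ∀ p → p ≡ 0 ⊎ (0 < p × p < m) ⊎ m ≤ p
    position zero = inj₁ refl
    position (suc p) with suc p <? m
    ... | yes 1+p<m = inj₂ (inj₁ (s≤s z≤n , 1+p<m))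
    ... | no 1+p≮m = inj₂ (inj₂ (≮⇒≥ 1+p≮m))

    beyond : ∀ {q} → m < q → q < n → q ≡ 1 + m ⊎ q ≡ 2 + m ⊎ q ≡ 3 + m
    beyond {q} m<q q<n with m≤n⇒m<n∨m≡n (≤-pred q<n)
    ... | inj₂ q≡3+m = inj₂ (inj₂ q≡3+m)
    ... | inj₁ q<3+m with m≤n⇒m<n∨m≡n (≤-pred q<3+m)
    ...   | inj₂ q≡2+m = inj₂ (inj₁ q≡2+m)
    ...   | inj₁ q<2+m = inj₁ (≤-antisym (≤-pred q<2+m) m<q)

    Crossed : Edge → Set
    Crossed g = Σ Edge λ h → h ∈ attachHub m D × (Crosses g h ⊎ Crosses h g)

    crossed-beyond : ∀ {p q} → IsDiagonal n (p , q) → (p , q) ∉ attachHub m D → m < q → Crossed (p , q)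
    crossed-beyond {p} {q} (p<q , q<n , not-side) g∉ m<q with position p | beyond m<q q<n
    ... | inj₂ (inj₁ (0<p , p<m)) | _ = (0 , m) , here refl , inj₂ (inj₁ (0<p , p<m , m<q))
    ... | inj₁ refl | inj₁ refl = (m , 2 + m) , there (here refl) , inj₁ (inj₁ (0<m , ≤-refl , ≤-refl))
    ... | inj₁ refl | inj₂ (inj₁ refl) = ⊥-elim (g∉ (there (there (here refl))))
    ... | inj₁ refl | inj₂ (inj₂ refl) = ⊥-elim (not-side (inj₂ (refl , refl)))
    ... | inj₂ (inj₂ m≤p) | inj₁ refl = ⊥-elim (not-side (inj₁ (cong suc (≤-antisym (≤-pred p<q) m≤p) , q<n)))
    ... | inj₂ (inj₂ m≤p) | inj₂ (inj₁ refl) with m≤n⇒m<n∨m≡n (≤-pred p<q)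
    ...   | inj₁ p<1+m = ⊥-elim (g∉ (there (here (cong (_, 2 + m) (≤-antisym (≤-pred p<1+m) m≤p)))))
    ...   | inj₂ refl = ⊥-elim (not-side (inj₁ (refl , q<n)))
    crossed-beyond {p} {q} (p<q , q<n , not-side) g∉ m<q | inj₂ (inj₂ m≤p) | inj₂ (inj₂ refl)
      with m≤n⇒m<n∨m≡n (≤-pred p<q)
    ...   | inj₁ p<2+m =
      (0 , 2 + m) , there (there (here refl)) , inj₂ (inj₁ (<-≤-trans 0<m m≤p , p<2+m , ≤-refl))
    ...   | inj₂ refl = ⊥-elim (not-side (inj₁ (refl , q<n)))

    old-diagonal : ∀ {p q} → IsDiagonal n (p , q) → (p , q) ∉ attachHub m D → q ≤ m →
                   IsDiagonal (suc m) (p , q)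
    old-diagonal (p<q , q<n , not-side) g∉ q≤m = p<q , s≤s q≤m , not-old-side
      where
      not-old-side : ¬ IsSide (suc m) _
      not-old-side (inj₁ (e , _)) = not-side (inj₁ (e , q<n))
      not-old-side (inj₂ (refl , refl)) = g∉ (here refl)

    maximality : (g : Edge) → IsDiagonal n g → g ∉ attachHub m D → Crossed g
    maximality (p , q) g-diagonal g∉ with q ≤? m
    ... | no q≰m = crossed-beyond g-diagonal g∉ (≰⇒> q≰m)
    ... | yes q≤m
      with proj₂ (proj₂ maximal) (p , q) (old-diagonal g-diagonal g∉ q≤m) (g∉ ∘ there ∘ there ∘ there)
    ...   | f , f∈D , crossing = f , there (there (there f∈D)) , crossing

  attachHub-maximal : IsMaxOuterplane (4 + m) (attachHub m D)
  attachHub-maximal =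
    s≤s (s≤s (s≤s z≤n)) , (0-m ∷ m-2+m ∷ 0-2+m ∷ All.map lift D-diagonals , unique , noncrossing) , maximality

no-diagonal-in-triangle : ∀ {e} → ¬ IsDiagonal 3 e
no-diagonal-in-triangle {0 , 1} (_ , _ , not-side) = not-side (inj₁ (refl , s≤s (s≤s z≤n)))
no-diagonal-in-triangle {0 , 2} (_ , _ , not-side) = not-side (inj₂ (refl , refl))
no-diagonal-in-triangle {1 , 2} (_ , _ , not-side) = not-side (inj₁ (refl , ≤-refl))
no-diagonal-in-triangle {0 , 0} (() , _)
no-diagonal-in-triangle {1 , 0} (() , _)
no-diagonal-in-triangle {1 , 1} (s≤s () , _)
no-diagonal-in-triangle {0 , suc (suc (suc _))} (_ , s≤s (s≤s (s≤s ())) , _)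
no-diagonal-in-triangle {1 , suc (suc (suc _))} (_ , s≤s (s≤s (s≤s ())) , _)
no-diagonal-in-triangle {suc (suc _) , q} (p<q , q<3 , _) = ≤⇒≯ (≤-pred q<3) (≤-trans (s≤s (s≤s (s≤s z≤n))) p<q)

triangle-maximal : IsMaxOuterplane 3 []
triangle-maximal =
  s≤s (s≤s (s≤s z≤n)) , ([] , [] , []) , λ _ g-diagonal _ → ⊥-elim (no-diagonal-in-triangle g-diagonal)

lastVertex : ℕ → ℕ
lastVertex zero = 2
lastVertex (suc k) = 3 + lastVertex k

family : ℕ → List Edge
family zero = []
family (suc k) = attachHub (lastVertex k) (family k)

family-maximal : ∀ k → IsMaxOuterplane (suc (lastVertex k)) (family k)
family-maximal zero = triangle-maximal
family-maximal (suc k) = attachHub-maximal (family-maximal k)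

family-size : ∀ k → suc (lastVertex k) ≡ 3 + 3 * k
family-size zero = refl
family-size (suc k) = cong (3 +_) (trans (family-size k) (sym (*-suc 3 k)))

-- The 3k internal edges of family k are the edges of the k triangles in hubs k.
hubs : ℕ → List (ℕ × ℕ × ℕ)
hubs zero = []
hubs (suc k) = (0 , lastVertex k , 2 + lastVertex k) ∷ hubs k

length-hubs : ∀ k → length (hubs k) ≡ k
length-hubs zero = refl
length-hubs (suc k) = cong suc (length-hubs k)

hub-edges-in-family : ∀ {k t e} → t ∈ hubs k → TriangleEdge t e → e ∈ family k
hub-edges-in-family {suc k} (here refl) (inj₁ refl) = here refl
hub-edges-in-family {suc k} (here refl) (inj₂ (inj₁ refl)) = there (here refl)
hub-edges-in-family {suc k} (here refl) (inj₂ (inj₂ refl)) = there (there (here refl))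
hub-edges-in-family {suc k} (there t∈) e∈t = there (there (there (hub-edges-in-family t∈ e∈t)))

family-covered-by-hubs : ∀ {k e} → e ∈ family k → Any (λ t → TriangleEdge t e) (hubs k)
family-covered-by-hubs {suc k} (here refl) = here (inj₁ refl)
family-covered-by-hubs {suc k} (there (here refl)) = here (inj₂ (inj₁ refl))
family-covered-by-hubs {suc k} (there (there (here refl))) = here (inj₂ (inj₂ refl))
family-covered-by-hubs {suc k} (there (there (there e∈))) = there (family-covered-by-hubs e∈)

2≤lastVertex : ∀ k → 2 ≤ lastVertex k
2≤lastVertex zero = ≤-refl
2≤lastVertex (suc k) = ≤-trans (2≤lastVertex k) (m≤n+m _ 3)

hubs-ordered : ∀ {k p q r} → (p , q , r) ∈ hubs k → p < q × q < r
hubs-ordered {suc k} (here refl) = ≤-trans (s≤s z≤n) (2≤lastVertex k) , s≤s (n≤1+n _)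
hubs-ordered {suc k} (there t∈) = hubs-ordered t∈

few-flippable-sets : (m : ℕ) → Σ ℕ λ n → m ≤ n × Σ (List Edge) λ D → IsMaxOuterplane n D ×
                     ((P : List (Edge × Edge)) → Flippable n D P → 3 * length P ≤ n ∸ 3)
few-flippable-sets k = suc (lastVertex k) , k≤n , family k , family-maximal k , bound
  where
  open MaximalOuterplane (family-maximal k)
  k≤n : k ≤ suc (lastVertex k)
  k≤n = subst (k ≤_) (sym (family-size k)) (≤-trans (m≤n*m k 3) (m≤n+m (3 * k) 3))
  hubs-are-triangles : ∀ {p q r} → (p , q , r) ∈ hubs k → IsTriangle p q r
  hubs-are-triangles t∈ = is-triangle (proj₁ (hubs-ordered t∈)) (proj₂ (hubs-ordered t∈))
    (inj₂ (hub-edges-in-family t∈ (inj₁ refl)))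
    (inj₂ (hub-edges-in-family t∈ (inj₂ (inj₁ refl))))
    (inj₂ (hub-edges-in-family t∈ (inj₂ (inj₂ refl))))
  bound : (P : List (Edge × Edge)) → Flippable (suc (lastVertex k)) (family k) P →
          3 * length P ≤ suc (lastVertex k) ∸ 3
  bound P flippable = subst (λ n → 3 * length P ≤ n ∸ 3) (sym (family-size k)) (*-monoʳ-≤ 3 (begin
    length P            ≡⟨ length-map proj₁ P ⟨
    length (FlipSet P)  ≤⟨ pigeonhole (λ e t → triangleEdge? t e) (hubs k) covered disjoint ⟩
    length (hubs k)     ≡⟨ length-hubs k ⟩
    k                   ∎))
    where
    open ≤-Reasoning
    covered : All (λ e → Any (λ t → TriangleEdge t e) (hubs k)) (FlipSet P)
    covered = All.map⁺ (All.map (family-covered-by-hubs ∘ proj₁) (proj₁ flippable))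
    disjoint : AllPairs (λ e f → ∀ {t} → t ∈ hubs k → TriangleEdge t e → TriangleEdge t f → ⊥) (FlipSet P)
    disjoint = AllPairs.map (λ no-common {t} t∈ → no-common (hubs-are-triangles t∈))
                            (flippable-one-per-triangle flippable)

mainTheorem10 : ((n : ℕ) (D : List Edge) → IsMaxOuterplane n D →
    Σ (List (Edge × Edge)) λ P → Flippable n D P × n ∸ 3 ≤ 3 * length P)
    ×
    ((m : ℕ) → Σ ℕ λ n → m ≤ n × Σ (List Edge) λ D → IsMaxOuterplane n D ×
    ((P : List (Edge × Edge)) → Flippable n D P → 3 * length P ≤ n ∸ 3))
mainTheorem10 = large-flippable-set , few-flippable-sets
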